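{- Let $M\in\mathbb{N}$, real numbers $p_1<\cdots<p_{M+1}$, $c_1,\ldots,c_{M+1}$ be given, $\Omega=\{1,\ldots,M+1\}$, $n\in\{1,\ldots,M\}$, $K\subset\Omega$ with $|K|=n+1$, and real numbers $t^{(n+1)}_0,\ldots,t^{(M)}_0$. Suppose $\mathbf{t}_0=\mathbf{t}_K(t^{(n+1)}_0,\ldots,t^{(M)}_0)\in\mathcal{P}_K$ is generic and visible, and put $\tau=t^{(n)}_K(t^{(n+1)}_0,\ldots,t^{(M)}_0)$. Then for each $k\in K$ there is $\varepsilon>0$ such that the points $\mathbf{t}_{K\setminus\{k\}}(\lambda,t^{(n+1)}_0,\ldots,t^{(M)}_0)$ are visible (as points of $\mathcal{P}_{K\setminus\{k\}}$) for all $\lambda$ with $\tau\le\lambda<\tau+\varepsilon$ if $k\in K_<$, and for all $\lambda$ with $\tau-\varepsilon<\lambda\le\tau$ if $k\in K_>$.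
   Context: On $\mathbb{R}^M$ with coordinates $\mathbf{t}=(t^{(1)},\ldots,t^{(M)})$ define $\theta_i(\mathbf{t})=\sum_{r=1}^M p_i^r t^{(r)}+c_i$, $i\in\Omega$. For nonempty $J\subset\Omega$ let $\mathcal{P}_J=\{\mathbf{t}:\theta_i(\mathbf{t})=\theta_j(\mathbf{t})\ \forall i,j\in J\}$ and $\mathcal{U}_J=\{\mathbf{t}:\theta_i(\mathbf{t})=\max_{j\in\Omega}\theta_j(\mathbf{t})\ \forall i\in J\}$. For $|J|=m$, the linear system $t^{(0)}+\sum_{r=1}^{m-1}p_i^r t^{(r)}=-c_i-\sum_{r=m}^M p_i^r t^{(r)}$, $i\in J$, uniquely determines $t^{(0)},\ldots,t^{(m-1)}$ as affine functions $t^{(k)}_J(t^{(m)},\ldots,t^{(M)})$ (constants if $m=M+1$); set $\mathbf{t}_J(t^{(m)},\ldots,t^{(M)})=(t^{(1)}_J,\ldots,t^{(m-1)}_J,t^{(m)},\ldots,t^{(M)})\in\mathcal{P}_J$. A point $\mathbf{t}\in\mathcal{P}_J$ is visible if $\mathbf{t}\in\mathcal{U}_J$, non-visible otherwise. A point $\mathbf{t}_0\in\mathcal{P}_K$ is generic if $\mathbf{t}_0\notin\mathcal{P}_J$ for every $J\subset\Omega$ with $|J|\ge2$ and $J\not\subset K$. For $S=\{s_1<\cdots<s_q\}$, $q\ge2$, let $S_>=\{s_j:j\equiv q\pmod 2\}$ and $S_<=\{s_j:j\equiv q-1\pmod 2\}$. -}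

module Defs where

open import Level using (0ℓ)
open import Data.Nat as ℕ using (ℕ; zero; suc)
open import Data.Fin as Fin using (Fin; toℕ; _<?_)
open import Data.Fin.Subset using (Subset; _∈_; _─_; ⁅_⁆; ∣_∣; inside; outside; _∩_; _⊆_)
open import Data.Nat.Divisibility using (_∣_)
open import Data.Vec using (tabulate)
open import Data.Product using (Σ; _×_; ∃)
open import Data.Sum using (_⊎_)
open import Relation.Nullary using (¬_; does)
open import Relation.Binary.PropositionalEquality using (_≡_)
open import Data.Bool using (if_then_else_)

record Reals : Set₁ where
  infixl 6 _+_ _-_
  infixl 7 _*_
  infix 4 _<_ _≤_
  field
    ℝ    : Set
    0r 1r : ℝ
    _+_ _*_ : ℝ → ℝ → ℝ
    -_   : ℝ → ℝ
    _<_  : ℝ → ℝ → Set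
    +-assoc : ∀ x y z → (x + y) + z ≡ x + (y + z)
    +-comm  : ∀ x y → x + y ≡ y + x
    +-idʳ   : ∀ x → x + 0r ≡ x
    +-invʳ  : ∀ x → x + (- x) ≡ 0r
    *-assoc : ∀ x y z → (x * y) * z ≡ x * (y * z)
    *-comm  : ∀ x y → x * y ≡ y * x
    *-idʳ   : ∀ x → x * 1r ≡ x
    *-invʳ  : ∀ x → ¬ (x ≡ 0r) → Σ ℝ (λ y → x * y ≡ 1r)
    distribʳ : ∀ x y z → (x + y) * z ≡ x * z + y * z
    0≢1     : ¬ (0r ≡ 1r)
    <-irrefl : ∀ x → ¬ (x < x)
    <-trans  : ∀ x y z → x < y → y < z → x < z
    <-trichotomy : ∀ x y → (x < y) ⊎ ((x ≡ y) ⊎ (y < x))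
    +-mono-< : ∀ x y z → x < y → x + z < y + z
    *-pos    : ∀ x y → 0r < x → 0r < y → 0r < x * y
    lub : (A : ℝ → Set) → ∃ A → ∃ (λ b → ∀ a → A a → (a < b ⊎ a ≡ b)) →
          Σ ℝ (λ s → (∀ a → A a → (a < s ⊎ a ≡ s)) ×
                     (∀ b → (∀ a → A a → (a < b ⊎ a ≡ b)) → (s < b ⊎ s ≡ b)))

  _≤_ : ℝ → ℝ → Set
  x ≤ y = x < y ⊎ x ≡ y

  _-_ : ℝ → ℝ → ℝ
  x - y = x + (- y)

  _^_ : ℝ → ℕ → ℝ
  x ^ zero  = 1r
  x ^ suc k = x * (x ^ k)

  Σ[_] : ∀ {m} → (Fin m → ℝ) → ℝ
  Σ[_] {zero}  f = 0r
  Σ[_] {suc m} f = f Fin.zero + Σ[_] (λ i → f (Fin.suc i))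

module Setting (R : Reals) {M : ℕ} (p c : Fin (suc M) → Reals.ℝ R) where
  open Reals R

  -- points t ∈ ℝ^M : the coordinate t^(r), r = 1..M, is  t r'  with toℕ r' = r - 1
  Point : Set
  Point = Fin M → ℝ

  θ : Fin (suc M) → Point → ℝ
  θ i t = Σ[ (λ r → (p i ^ suc (toℕ r)) * t r) ] + c i

  InP : Subset (suc M) → Point → Set
  InP J t = ∀ i j → i ∈ J → j ∈ J → θ i t ≡ θ j t

  InU : Subset (suc M) → Point → Set
  InU J t = ∀ i → i ∈ J → ∀ j → θ j t ≤ θ i t

  Visible : Subset (suc M) → Point → Set
  Visible J t = InP J t × InU J t

  -- t is the point t_J(v^(m),…,v^(M)) with m = |J|: t ∈ 𝒫_J and its coordinates
  -- t^(r) for r ≥ m are the prescribed ones (v^(r)); the remaining coordinates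
  -- are then uniquely determined (Vandermonde system).
  IsTJ : Subset (suc M) → Point → Point → Set
  IsTJ J v t = InP J t × (∀ r → ∣ J ∣ ℕ.≤ suc (toℕ r) → t r ≡ v r)

  Generic : Subset (suc M) → Point → Set
  Generic K t = ∀ (J : Subset (suc M)) → 2 ℕ.≤ ∣ J ∣ →
                ¬ (J ⊆ K) → ¬ InP J t

Above : ∀ {N} → Fin N → Subset N
Above k = tabulate (λ i → if does (k <? i) then inside else outside)

-- For S = {s_1 < ⋯ < s_q} and k = s_j ∈ S, the number of elements of S above k
-- is q - j; hence k ∈ S_> (j ≡ q mod 2) iff this number is even,
-- and k ∈ S_< (j ≡ q - 1 mod 2) iff it is odd.
InGt : ∀ {N} → Subset N → Fin N → Set
InGt S k = k ∈ S × 2 ∣ ∣ S ∩ Above k ∣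

InLt : ∀ {N} → Subset N → Fin N → Set
InLt S k = k ∈ S × ¬ (2 ∣ ∣ S ∩ Above k ∣)

module Submission where

open import Defs
open import Data.Nat using (ℕ; suc)
open import Data.Fin using (Fin; toℕ) renaming (_<_ to _<ᶠ_)
open import Data.Fin.Subset using (Subset; _∈_; _─_; ⁅_⁆; ∣_∣)
open import Data.Vec.Functional using (updateAt)
open import Data.Product using (Σ; _×_)
open import Relation.Binary.PropositionalEquality using (_≡_)

open import Level using (0ℓ)
open import Algebra.Bundles using (CommutativeRing)
open import Algebra.Structures using (IsCommutativeRing)
open import Algebra.Consequences.Propositional using (comm∧idʳ⇒id; comm∧invʳ⇒inv; comm∧distrʳ⇒distrˡ)
import Algebra.Properties.Ring as RingProperties
import Algebra.Properties.CommutativeSemigroup as CommutativeSemigroupProperties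
import Algebra.Properties.Semiring.Sum as SemiringSum
import Data.Nat as ℕ
open import Data.Nat using (zero)
import Data.Nat.Properties as ℕₚ
open import Data.Nat.Divisibility using (_∣_; ∣m+n∣m⇒∣n; ∣m∣n⇒∣m+n; ∣1⇒≡1; ∣-refl; _∣0)
import Data.Fin as Fin
open import Data.Fin.Properties as Finₚ using () renaming (_≟_ to _≟ᶠ_)
open import Data.Fin.Subset using (_∉_; _∩_; _∪_; inside; outside)
open import Data.Fin.Subset.Properties
  using (p─⊥≡p; _∈?_; x∈p∪q⁻; p⊆p∪q; q⊆p∪q; x∈⁅x⁆; x∈⁅y⁆⇒x≡y; p⊆q⇒∣p∣≤∣q∣; p─q⊆p; x∈p∧x≢y⇒x∈p-y)
open import Data.Vec using (Vec; []; _∷_; tabulate; last)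
open import Data.Vec.Base using (here; there)
open import Data.Vec.Functional.Properties using (updateAt-updates; updateAt-minimal)
open import Data.Product using (_,_; proj₁; proj₂)
open import Data.Sum using (_⊎_; inj₁; inj₂)
open import Data.Empty using (⊥-elim)
open import Function.Definitions using (Injective)
open import Relation.Nullary using (¬_; yes; no)
open import Relation.Binary.Definitions using (tri<; tri≈; tri>)
open import Relation.Binary.PropositionalEquality using (refl; sym; trans; cong; cong₂; subst; subst₂; isEquivalence; module ≡-Reasoning)

-- Let t = t_{K∖k}(λ, t₀^(n+1), …) and δ = λ - τ.  As t and t₀ differ only in the
-- coordinates up to n, θ_a(t) - θ_a(t₀) = D(p_a) for a polynomial D of degree ≤ n + 1
-- with leading coefficient δ.  D is constant on the n + 1 nodes p_l, l ∈ K∖k, so by the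
-- factor theorem, for i ∈ K∖k and every j,
--     θ_j(t) - θ_i(t) = (θ_j(t₀) - θ_k(t₀)) + δ · ∏_{l ∈ K∖k} (p_j - p_l).
-- For j ∉ K the first term is negative (genericity and visibility of t₀) and stays
-- dominant for small |δ|; for j = k it vanishes, so visibility needs δ·∏(p_k - p_l) ≤ 0,
-- and that product has sign (-1)^#{l ∈ K : l > k}: negative for k ∈ K_<, positive for K_>.

∣S─k∣+1≡∣S∣ : ∀ {m} (S : Subset m) (k : Fin m) → k ∈ S → suc ∣ S ─ ⁅ k ⁆ ∣ ≡ ∣ S ∣
∣S─k∣+1≡∣S∣ (inside ∷ S) Fin.zero here = cong (λ T → suc ∣ T ∣) (p─⊥≡p S)
∣S─k∣+1≡∣S∣ (inside ∷ S) (Fin.suc k) (there k∈S) = cong suc (∣S─k∣+1≡∣S∣ S k k∈S)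
∣S─k∣+1≡∣S∣ (outside ∷ S) (Fin.suc k) (there k∈S) = ∣S─k∣+1≡∣S∣ S k k∈S

-- Intersecting with the full subset changes nothing; written as a tabulation,
-- this is the shape in which Above 0 presents the indices above 0.
∣S∩full∣≡∣S∣ : ∀ {m} (S : Subset m) → ∣ S ∩ tabulate (λ _ → inside) ∣ ≡ ∣ S ∣
∣S∩full∣≡∣S∣ [] = refl
∣S∩full∣≡∣S∣ (inside ∷ S) = cong suc (∣S∩full∣≡∣S∣ S)
∣S∩full∣≡∣S∣ (outside ∷ S) = ∣S∩full∣≡∣S∣ S

even⇒odd-suc : ∀ n → 2 ∣ n → ¬ (2 ∣ suc n)
even⇒odd-suc n 2∣n 2∣1+n with ∣1⇒≡1 (∣m+n∣m⇒∣n (subst (2 ∣_) (ℕₚ.+-comm 1 n) 2∣1+n) 2∣n)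
... | ()

module OrderedField (R : Reals) where
  open Reals R
  open ≡-Reasoning

  ℝ-isCommutativeRing : IsCommutativeRing _≡_ _+_ _*_ -_ 0r 1r
  ℝ-isCommutativeRing = record
    { isRing = record
      { +-isAbelianGroup = record
        { isGroup = record
          { isMonoid = record
            { isSemigroup = record
              { isMagma = record { isEquivalence = isEquivalence ; ∙-cong = cong₂ _+_ }
              ; assoc = +-assoc }
            ; identity = comm∧idʳ⇒id +-comm +-idʳ }
          ; inverse = comm∧invʳ⇒inv +-comm +-invʳ
          ; ⁻¹-cong = cong (λ x → - x) }
        ; comm = +-comm }
      ; *-cong = cong₂ _*_
      ; *-assoc = *-assoc
      ; *-identity = comm∧idʳ⇒id *-comm *-idʳ
      ; distrib = comm∧distrʳ⇒distrˡ *-comm distribʳ′ , distribʳ′ }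
    ; *-comm = *-comm }
    where
    distribʳ′ : ∀ x y z → (y + z) * x ≡ y * x + z * x
    distribʳ′ x y z = distribʳ y z x

  ℝ-commutativeRing : CommutativeRing 0ℓ 0ℓ
  ℝ-commutativeRing = record { isCommutativeRing = ℝ-isCommutativeRing }

  open CommutativeRing ℝ-commutativeRing public
    using (ring; semiring; +-commutativeSemigroup; *-commutativeSemigroup; +-identityˡ; -‿inverseˡ; distribˡ; zeroˡ; zeroʳ; *-identityˡ)
  open RingProperties ring public
    using (-0#≈0#; -‿involutive; -‿distribˡ-*; -‿distribʳ-*; +-cancelˡ; x∙y⁻¹≈ε⇒x≈y; xyx⁻¹≈y; ⁻¹-anti-homo‿-; [y-z]x≈yx-zx)

  open CommutativeSemigroupProperties *-commutativeSemigroup public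
    using () renaming (x∙yz≈y∙xz to x*[y*z]≡y*[x*z])
  open CommutativeSemigroupProperties +-commutativeSemigroup public
    using () renaming (x∙yz≈y∙xz to x+[y+z]≡y+[x+z]; xy∙z≈xz∙y to [x+y]+z≡[x+z]+y)

  x+[y-x]≡y : ∀ x y → x + (y - x) ≡ y
  x+[y-x]≡y x y = trans (sym (+-assoc x y (- x))) (xyx⁻¹≈y x y)

  -x+y≡z⇒y≡x+z : ∀ x y z → - x + y ≡ z → y ≡ x + z
  -x+y≡z⇒y≡x+z x y z e = begin
    y                ≡⟨ sym (xyx⁻¹≈y (- x) y) ⟩
    - x + y - - x    ≡⟨ cong₂ _+_ e (-‿involutive x) ⟩
    z + x            ≡⟨ +-comm z x ⟩
    x + z            ∎

  x≢0∧xy≡0⇒y≡0 : ∀ x y → ¬ (x ≡ 0r) → x * y ≡ 0r → y ≡ 0r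
  x≢0∧xy≡0⇒y≡0 x y x≢0 xy≡0 with *-invʳ x x≢0
  ... | (x⁻¹ , xx⁻¹≡1) = begin
    y              ≡⟨ sym (*-identityˡ y) ⟩
    1r * y         ≡⟨ cong (_* y) (trans (sym xx⁻¹≡1) (*-comm x x⁻¹)) ⟩
    (x⁻¹ * x) * y  ≡⟨ *-assoc x⁻¹ x y ⟩
    x⁻¹ * (x * y)  ≡⟨ cong (x⁻¹ *_) xy≡0 ⟩
    x⁻¹ * 0r       ≡⟨ zeroʳ x⁻¹ ⟩
    0r             ∎

  x≢y⇒x-y≢0 : ∀ x y → ¬ (x ≡ y) → ¬ (x - y ≡ 0r)
  x≢y⇒x-y≢0 x y x≢y x-y≡0 = x≢y (x∙y⁻¹≈ε⇒x≈y x y x-y≡0)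

  <-≤-trans : ∀ {x y z} → x < y → y ≤ z → x < z
  <-≤-trans x<y (inj₁ y<z) = <-trans _ _ _ x<y y<z
  <-≤-trans x<y (inj₂ refl) = x<y

  ≤-<-trans : ∀ {x y z} → x ≤ y → y < z → x < z
  ≤-<-trans (inj₁ x<y) y<z = <-trans _ _ _ x<y y<z
  ≤-<-trans (inj₂ refl) y<z = y<z

  <⇒≢ : ∀ {x y} → x < y → ¬ (x ≡ y)
  <⇒≢ {x} x<y refl = <-irrefl x x<y

  +-monoˡ-< : ∀ z {x y} → x < y → z + x < z + y
  +-monoˡ-< z {x} {y} x<y = subst₂ _<_ (+-comm x z) (+-comm y z) (+-mono-< x y z x<y)

  +-monoˡ-≤ : ∀ z {x y} → x ≤ y → z + x ≤ z + y
  +-monoˡ-≤ z (inj₁ x<y) = inj₁ (+-monoˡ-< z x<y)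
  +-monoˡ-≤ z (inj₂ refl) = inj₂ refl

  x<y⇒0<y-x : ∀ {x y} → x < y → 0r < y - x
  x<y⇒0<y-x {x} {y} x<y = subst (_< y - x) (+-invʳ x) (+-mono-< x y (- x) x<y)

  x<y⇒x-y<0 : ∀ {x y} → x < y → x - y < 0r
  x<y⇒x-y<0 {x} {y} x<y = subst (x - y <_) (+-invʳ y) (+-mono-< x y (- y) x<y)

  0<y-x⇒x<y : ∀ {x y} → 0r < y - x → x < y
  0<y-x⇒x<y {x} {y} 0<y-x =
    subst₂ _<_ (+-identityˡ x) (trans (+-comm (y - x) x) (x+[y-x]≡y x y)) (+-mono-< 0r (y - x) x 0<y-x)

  0<x⇒-x<0 : ∀ {x} → 0r < x → - x < 0r
  0<x⇒-x<0 {x} 0<x = subst (_< 0r) (+-identityˡ (- x)) (x<y⇒x-y<0 0<x)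

  x<0⇒0<-x : ∀ {x} → x < 0r → 0r < - x
  x<0⇒0<-x {x} x<0 = subst (0r <_) (+-identityˡ (- x)) (x<y⇒0<y-x x<0)

  0<-x⇒x<0 : ∀ {x} → 0r < - x → x < 0r
  0<-x⇒x<0 {x} 0<-x = subst (_< 0r) (-‿involutive x) (0<x⇒-x<0 0<-x)

  0≤x⇒-x≤0 : ∀ {x} → 0r ≤ x → - x ≤ 0r
  0≤x⇒-x≤0 (inj₁ 0<x) = inj₁ (0<x⇒-x<0 0<x)
  0≤x⇒-x≤0 (inj₂ refl) = inj₂ -0#≈0#

  x≤y⇒0≤y-x : ∀ {x y} → x ≤ y → 0r ≤ y - x
  x≤y⇒0≤y-x (inj₁ x<y) = inj₁ (x<y⇒0<y-x x<y)
  x≤y⇒0≤y-x {x} (inj₂ refl) = inj₂ (sym (+-invʳ x))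

  x≤y⇒x-y≤0 : ∀ {x y} → x ≤ y → x - y ≤ 0r
  x≤y⇒x-y≤0 (inj₁ x<y) = inj₁ (x<y⇒x-y<0 x<y)
  x≤y⇒x-y≤0 {x} (inj₂ refl) = inj₂ (+-invʳ x)

  [x-y]+[y-z]≡x-z : ∀ x y z → (x - y) + (y - z) ≡ x - z
  [x-y]+[y-z]≡x-z x y z = begin
    (x - y) + (y - z)    ≡⟨ +-assoc x (- y) (y - z) ⟩
    x + (- y + (y - z))  ≡⟨ cong (x +_) (sym (+-assoc (- y) y (- z))) ⟩
    x + ((- y + y) - z)  ≡⟨ cong (λ w → x + (w - z)) (-‿inverseˡ y) ⟩
    x + (0r - z)         ≡⟨ cong (x +_) (+-identityˡ (- z)) ⟩
    x - z                ∎

  x-y<z⇒x-z<y : ∀ {x y z} → x - y < z → x - z < y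
  x-y<z⇒x-z<y {x} {y} {z} x-y<z =
    subst₂ _<_ ([x-y]+[y-z]≡x-z x y z) (x+[y-x]≡y z y)
      (+-mono-< (x - y) z (y - z) x-y<z)

  -x*-y≡x*y : ∀ x y → - x * - y ≡ x * y
  -x*-y≡x*y x y = begin
    - x * - y       ≡⟨ sym (-‿distribˡ-* x (- y)) ⟩
    - (x * - y)     ≡⟨ cong (λ z → - z) (sym (-‿distribʳ-* x y)) ⟩
    - (- (x * y))   ≡⟨ -‿involutive (x * y) ⟩
    x * y           ∎

  neg*pos : ∀ {x y} → x < 0r → 0r < y → x * y < 0r
  neg*pos {x} {y} x<0 0<y =
    0<-x⇒x<0 (subst (0r <_) (sym (-‿distribˡ-* x y)) (*-pos (- x) y (x<0⇒0<-x x<0) 0<y))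

  pos*neg : ∀ {x y} → 0r < x → y < 0r → x * y < 0r
  pos*neg {x} {y} 0<x y<0 = subst (_< 0r) (*-comm y x) (neg*pos y<0 0<x)

  neg*neg : ∀ {x y} → x < 0r → y < 0r → 0r < x * y
  neg*neg {x} {y} x<0 y<0 = subst (0r <_) (-x*-y≡x*y x y) (*-pos _ _ (x<0⇒0<-x x<0) (x<0⇒0<-x y<0))

  nonneg*nonpos : ∀ {x y} → 0r ≤ x → y ≤ 0r → x * y ≤ 0r
  nonneg*nonpos (inj₁ 0<x) (inj₁ y<0) = inj₁ (pos*neg 0<x y<0)
  nonneg*nonpos {x} _ (inj₂ refl) = inj₂ (zeroʳ x)
  nonneg*nonpos {y = y} (inj₂ refl) _ = inj₂ (zeroˡ y)

  0<1 : 0r < 1r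
  0<1 with <-trichotomy 0r 1r
  ... | inj₁ 0<1 = 0<1
  ... | inj₂ (inj₁ 0≡1) = ⊥-elim (0≢1 0≡1)
  ... | inj₂ (inj₂ 1<0) = ⊥-elim (<-irrefl 1r (<-trans 1r 0r 1r 1<0 0<1′))
    where
    -- 1 < 0 would make 1 = (-1)·(-1) positive.
    0<1′ : 0r < 1r
    0<1′ = subst (0r <_) (trans (-x*-y≡x*y 1r 1r) (*-idʳ 1r)) (*-pos _ _ (x<0⇒0<-x 1<0) (x<0⇒0<-x 1<0))

  *-monoʳ-< : ∀ {x y z} → 0r < z → x < y → x * z < y * z
  *-monoʳ-< {x} {y} {z} 0<z x<y =
    0<y-x⇒x<y (subst (0r <_) ([y-z]x≈yx-zx z y x) (*-pos _ _ (x<y⇒0<y-x x<y) 0<z))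

  inverse-pos : ∀ {q q⁻¹} → 0r < q → q * q⁻¹ ≡ 1r → 0r < q⁻¹
  inverse-pos {q} {q⁻¹} 0<q qq⁻¹≡1 with <-trichotomy 0r q⁻¹
  ... | inj₁ 0<q⁻¹ = 0<q⁻¹
  ... | inj₂ (inj₁ refl) = ⊥-elim (0≢1 (trans (sym (zeroʳ q)) qq⁻¹≡1))
  ... | inj₂ (inj₂ q⁻¹<0) = ⊥-elim (<-irrefl 0r (<-trans 0r 1r 0r 0<1 (subst (_< 0r) qq⁻¹≡1 (pos*neg 0<q q⁻¹<0))))

module Polynomials (R : Reals) where
  open Reals R
  open OrderedField R
  open ≡-Reasoning

  -- A polynomial is given by its coefficient vector, constant term first, and
  -- evaluated by Horner's rule; its leading coefficient is the last entry.
  eval : ∀ {m} → Vec ℝ m → ℝ → ℝ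
  eval [] y = 0r
  eval (a ∷ as) y = a + y * eval as y

  -- Synthetic division: the coefficients of the quotient of Q by (y - x).
  quotient : ∀ {m} → ℝ → Vec ℝ (suc m) → Vec ℝ m
  quotient x (a ∷ []) = []
  quotient x (a ∷ b ∷ bs) = eval (b ∷ bs) x ∷ quotient x (b ∷ bs)

  last-quotient : ∀ {m} x (Q : Vec ℝ (suc (suc m))) → last (quotient x Q) ≡ last Q
  last-quotient x (a ∷ b ∷ []) = trans (cong (b +_) (zeroʳ x)) (+-idʳ b)
  last-quotient x (a ∷ b ∷ c ∷ cs) = last-quotient x (b ∷ c ∷ cs)

  division : ∀ {m} x (Q : Vec ℝ (suc m)) y → eval Q y ≡ eval Q x + (y - x) * eval (quotient x Q) y
  division x (a ∷ []) y = trans (constant y) (sym (trans (cong (_+ (y - x) * 0r) (constant x)) (constant (y - x))))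
    where
    constant : ∀ z → a + z * 0r ≡ a
    constant z = trans (cong (a +_) (zeroʳ z)) (+-idʳ a)
  division x (a ∷ B@(b ∷ bs)) y = begin
    a + y * eval B y                                ≡⟨ cong (λ z → a + y * z) (division x B y) ⟩
    a + y * (Bx + h * qy)                           ≡⟨ cong (a +_) (distribˡ y Bx (h * qy)) ⟩
    a + (y * Bx + y * (h * qy))                     ≡⟨ cong₂ (λ u v → a + (u + v)) y*Bx (x*[y*z]≡y*[x*z] y h qy) ⟩
    a + ((x * Bx + h * Bx) + h * (y * qy))          ≡⟨ cong (a +_) (+-assoc (x * Bx) (h * Bx) _) ⟩
    a + (x * Bx + (h * Bx + h * (y * qy)))          ≡⟨ sym (+-assoc a (x * Bx) _) ⟩
    (a + x * Bx) + (h * Bx + h * (y * qy))          ≡⟨ cong ((a + x * Bx) +_) (sym (distribˡ h Bx (y * qy))) ⟩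
    (a + x * Bx) + h * (Bx + y * qy)                ∎
    where
    h Bx qy : ℝ
    h = y - x
    Bx = eval B x
    qy = eval (quotient x B) y
    y*Bx : y * Bx ≡ x * Bx + h * Bx
    y*Bx = trans (cong (_* Bx) (sym (x+[y-x]≡y x y))) (distribʳ x h Bx)

  quotient-root : ∀ {m} x z (Q : Vec ℝ (suc m)) →
                  eval Q x ≡ 0r → eval Q z ≡ 0r → ¬ (z ≡ x) → eval (quotient x Q) z ≡ 0r
  quotient-root x z Q Qx≡0 Qz≡0 z≢x = x≢0∧xy≡0⇒y≡0 (z - x) _ (x≢y⇒x-y≢0 z x z≢x) (begin
    (z - x) * eval (quotient x Q) z             ≡⟨ sym (+-identityˡ _) ⟩
    0r + (z - x) * eval (quotient x Q) z        ≡⟨ cong (_+ (z - x) * eval (quotient x Q) z) (sym Qx≡0) ⟩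
    eval Q x + (z - x) * eval (quotient x Q) z  ≡⟨ sym (division x Q z) ⟩
    eval Q z                                    ≡⟨ Qz≡0 ⟩
    0r                                          ∎)

  open SemiringSum semiring using (sum; sum-cong-≗; sum-replicate-zero; ∑-distrib-+; *-distribˡ-sum)

  Σ≡sum : ∀ {m} (f : Fin m → ℝ) → Σ[ f ] ≡ sum f
  Σ≡sum {zero} f = refl
  Σ≡sum {suc m} f = cong (f Fin.zero +_) (Σ≡sum (λ i → f (Fin.suc i)))

  Σ-cong : ∀ {m} {f g : Fin m → ℝ} → (∀ r → f r ≡ g r) → Σ[ f ] ≡ Σ[ g ]
  Σ-cong {f = f} {g} f≗g = trans (Σ≡sum f) (trans (sum-cong-≗ f≗g) (sym (Σ≡sum g)))

  Σ-+ : ∀ {m} (f g : Fin m → ℝ) → Σ[ (λ r → f r + g r) ] ≡ Σ[ f ] + Σ[ g ]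
  Σ-+ f g = trans (Σ≡sum (λ r → f r + g r)) (trans (∑-distrib-+ f g) (sym (cong₂ _+_ (Σ≡sum f) (Σ≡sum g))))

  Σ-scale : ∀ {m} y (f : Fin m → ℝ) → Σ[ (λ r → y * f r) ] ≡ y * Σ[ f ]
  Σ-scale y f = trans (Σ≡sum (λ r → y * f r)) (sym (trans (cong (y *_) (Σ≡sum f)) (*-distribˡ-sum y f)))

  Σ-zero : ∀ {m} (f : Fin m → ℝ) → (∀ r → f r ≡ 0r) → Σ[ f ] ≡ 0r
  Σ-zero {m} f f≡0 = trans (Σ≡sum f) (trans (sum-cong-≗ f≡0) (sum-replicate-zero m))

  prefix : ∀ {m} (n : Fin m) → (Fin m → ℝ) → Vec ℝ (suc (toℕ n))
  prefix Fin.zero d = d Fin.zero ∷ []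
  prefix (Fin.suc n) d = d Fin.zero ∷ prefix n (λ r → d (Fin.suc r))

  last-prefix : ∀ {m} (n : Fin m) d → last (prefix n d) ≡ d n
  last-prefix Fin.zero d = refl
  last-prefix (Fin.suc n) d = last-prefix n (λ r → d (Fin.suc r))

  power-sum-as-horner : ∀ {m} (n : Fin m) (d : Fin m → ℝ) → (∀ r → toℕ n ℕ.< toℕ r → d r ≡ 0r) →
                        ∀ y → Σ[ (λ r → (y ^ suc (toℕ r)) * d r) ] ≡ y * eval (prefix n d) y
  power-sum-as-horner {suc m} Fin.zero d d-vanishes y = begin
    (y * 1r) * d Fin.zero + Σ[ (λ r → (y * (y ^ suc (toℕ r))) * d (Fin.suc r)) ]
      ≡⟨ cong₂ _+_ (cong (_* d Fin.zero) (*-idʳ y)) (Σ-zero _ higher-terms) ⟩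
    y * d Fin.zero + 0r              ≡⟨ +-idʳ _ ⟩
    y * d Fin.zero                   ≡⟨ cong (y *_) (sym (trans (cong (d Fin.zero +_) (zeroʳ y)) (+-idʳ _))) ⟩
    y * (d Fin.zero + y * 0r)        ∎
    where
    higher-terms : ∀ r → (y * (y ^ suc (toℕ r))) * d (Fin.suc r) ≡ 0r
    higher-terms r = trans (cong (_ *_) (d-vanishes (Fin.suc r) (ℕ.s≤s ℕ.z≤n))) (zeroʳ _)
  power-sum-as-horner {suc m} (Fin.suc n) d d-vanishes y = begin
    (y * 1r) * d Fin.zero + Σ[ (λ r → (y * (y ^ suc (toℕ r))) * d′ r) ]
      ≡⟨ cong₂ _+_ (cong (_* d Fin.zero) (*-idʳ y)) (trans (Σ-cong (λ r → *-assoc y (y ^ suc (toℕ r)) (d′ r))) (Σ-scale y (λ r → (y ^ suc (toℕ r)) * d′ r))) ⟩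
    y * d Fin.zero + y * Σ[ (λ r → (y ^ suc (toℕ r)) * d′ r) ]
      ≡⟨ cong (λ z → y * d Fin.zero + y * z) (power-sum-as-horner n d′ d′-vanishes y) ⟩
    y * d Fin.zero + y * (y * eval (prefix n d′) y)
      ≡⟨ sym (distribˡ y (d Fin.zero) _) ⟩
    y * (d Fin.zero + y * eval (prefix n d′) y)
      ∎
    where
    d′ : Fin m → ℝ
    d′ r = d (Fin.suc r)
    d′-vanishes : ∀ r → toℕ n ℕ.< toℕ r → d′ r ≡ 0r
    d′-vanishes r n<r = d-vanishes (Fin.suc r) (ℕ.s≤s n<r)

  ∏ : ∀ {m} → Subset m → (Fin m → ℝ) → ℝ
  ∏ [] g = 1r
  ∏ (inside ∷ S) g = g Fin.zero * ∏ S (λ i → g (Fin.suc i))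
  ∏ (outside ∷ S) g = ∏ S (λ i → g (Fin.suc i))

  factor-theorem : ∀ {m N} (S : Subset m) (f : Fin m → ℝ) → Injective _≡_ _≡_ f → ∣ S ∣ ≡ N →
                   (Q : Vec ℝ (suc N)) → (∀ i → i ∈ S → eval Q (f i) ≡ 0r) →
                   ∀ y → eval Q y ≡ last Q * ∏ S (λ i → y - f i)
  factor-theorem [] f _ refl (a ∷ []) _ y =
    trans (cong (a +_) (zeroʳ y)) (trans (+-idʳ a) (sym (*-idʳ a)))
  factor-theorem (outside ∷ S) f f-inj ∣S∣≡N Q roots y =
    factor-theorem S (λ i → f (Fin.suc i)) (λ e → Finₚ.suc-injective (f-inj e)) ∣S∣≡N Q
      (λ i i∈S → roots (Fin.suc i) (there i∈S)) y
  factor-theorem (inside ∷ S) f f-inj refl Q roots y = begin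
    eval Q y                              ≡⟨ division x Q y ⟩
    eval Q x + (y - x) * eval Q′ y        ≡⟨ cong (_+ (y - x) * eval Q′ y) (roots Fin.zero here) ⟩
    0r + (y - x) * eval Q′ y              ≡⟨ +-identityˡ _ ⟩
    (y - x) * eval Q′ y                   ≡⟨ cong ((y - x) *_) (factor-theorem S f′ f′-inj refl Q′ roots′ y) ⟩
    (y - x) * (last Q′ * P)               ≡⟨ cong (λ c → (y - x) * (c * P)) (last-quotient x Q) ⟩
    (y - x) * (last Q * P)                ≡⟨ x*[y*z]≡y*[x*z] (y - x) (last Q) P ⟩
    last Q * ((y - x) * P)                ∎
    where
    x : ℝ
    x = f Fin.zero
    f′ : Fin _ → ℝ
    f′ i = f (Fin.suc i)
    f′-inj : Injective _≡_ _≡_ f′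
    f′-inj e = Finₚ.suc-injective (f-inj e)
    Q′ : Vec ℝ (suc ∣ S ∣)
    Q′ = quotient x Q
    P : ℝ
    P = ∏ S (λ i → y - f′ i)
    roots′ : ∀ i → i ∈ S → eval Q′ (f′ i) ≡ 0r
    roots′ i i∈S = quotient-root x (f′ i) Q (roots Fin.zero here) (roots (Fin.suc i) (there i∈S))
                     (λ e → Finₚ.0≢1+n (sym (f-inj e)))

module ProductSign (R : Reals) where
  open Reals R
  open OrderedField R
  open Polynomials R using (∏)

  HasSign : ℕ → ℝ → Set
  HasSign c P = (2 ∣ c × 0r < P) ⊎ (2 ∣ suc c × P < 0r)

  ∏-negatives : ∀ {m} (S : Subset m) (g : Fin m → ℝ) → (∀ j → g j < 0r) → HasSign ∣ S ∣ (∏ S g)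
  ∏-negatives [] g _ = inj₁ (2 ∣0 , 0<1)
  ∏-negatives (outside ∷ S) g g<0 = ∏-negatives S (λ i → g (Fin.suc i)) (λ i → g<0 (Fin.suc i))
  ∏-negatives (inside ∷ S) g g<0 with ∏-negatives S (λ i → g (Fin.suc i)) (λ i → g<0 (Fin.suc i))
  ... | inj₁ (even , 0<P) = inj₂ (∣m∣n⇒∣m+n ∣-refl even , neg*pos (g<0 Fin.zero) 0<P)
  ... | inj₂ (even , P<0) = inj₁ (even , neg*neg (g<0 Fin.zero) P<0)

  pos*HasSign : ∀ {a c P} → 0r < a → HasSign c P → HasSign c (a * P)
  pos*HasSign 0<a (inj₁ (even , 0<P)) = inj₁ (even , *-pos _ _ 0<a 0<P)
  pos*HasSign 0<a (inj₂ (odd , P<0)) = inj₂ (odd , pos*neg 0<a P<0)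

  StrictlyIncreasing : ∀ {m} → (Fin m → ℝ) → Set
  StrictlyIncreasing f = ∀ i j → i <ᶠ j → f i < f j

  increasing-tail : ∀ {m} {f : Fin (suc m) → ℝ} → StrictlyIncreasing f → StrictlyIncreasing (λ i → f (Fin.suc i))
  increasing-tail f-inc i j i<j = f-inc (Fin.suc i) (Fin.suc j) (ℕ.s≤s i<j)

  strictlyIncreasing⇒injective : ∀ {m} {f : Fin m → ℝ} → StrictlyIncreasing f → Injective _≡_ _≡_ f
  strictlyIncreasing⇒injective {f = f} f-inc {i} {j} fi≡fj with Finₚ.<-cmp i j
  ... | tri< i<j _ _ = ⊥-elim (<⇒≢ (f-inc i j i<j) fi≡fj)
  ... | tri≈ _ i≡j _ = i≡j
  ... | tri> _ _ j<i = ⊥-elim (<⇒≢ (f-inc j i j<i) (sym fi≡fj))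

  -- For increasing f, the product ∏_{j ∈ S, j ≠ k} (f(k) - f(j)) has one negative
  -- factor for each member of S above k, and all other factors positive.
  ∏-differences-sign : ∀ {m} (S : Subset m) (f : Fin m → ℝ) → StrictlyIncreasing f →
                       ∀ k → k ∈ S → HasSign ∣ S ∩ Above k ∣ (∏ (S ─ ⁅ k ⁆) (λ j → f k - f j))
  ∏-differences-sign (inside ∷ S) f f-inc Fin.zero here =
    subst₂ HasSign (sym (∣S∩full∣≡∣S∣ S)) (cong (λ T → ∏ (outside ∷ T) (λ j → f Fin.zero - f j)) (sym (p─⊥≡p S)))
      (∏-negatives S (λ j → f Fin.zero - f (Fin.suc j)) (λ j → x<y⇒x-y<0 (f-inc Fin.zero (Fin.suc j) (ℕ.s≤s ℕ.z≤n))))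
  ∏-differences-sign (outside ∷ S) f f-inc (Fin.suc k) (there k∈S) =
    ∏-differences-sign S (λ i → f (Fin.suc i)) (increasing-tail f-inc) k k∈S
  ∏-differences-sign (inside ∷ S) f f-inc (Fin.suc k) (there k∈S) =
    pos*HasSign (x<y⇒0<y-x (f-inc Fin.zero (Fin.suc k) (ℕ.s≤s ℕ.z≤n)))
      (∏-differences-sign S (λ i → f (Fin.suc i)) (increasing-tail f-inc) k k∈S)

  InLt⇒∏<0 : ∀ {m} (S : Subset m) (f : Fin m → ℝ) → StrictlyIncreasing f →
             ∀ k → InLt S k → ∏ (S ─ ⁅ k ⁆) (λ j → f k - f j) < 0r
  InLt⇒∏<0 S f f-inc k (k∈S , odd) with ∏-differences-sign S f f-inc k k∈S
  ... | inj₁ (even , _) = ⊥-elim (odd even)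
  ... | inj₂ (_ , P<0) = P<0

  InGt⇒0<∏ : ∀ {m} (S : Subset m) (f : Fin m → ℝ) → StrictlyIncreasing f →
             ∀ k → InGt S k → 0r < ∏ (S ─ ⁅ k ⁆) (λ j → f k - f j)
  InGt⇒0<∏ S f f-inc k (k∈S , even) with ∏-differences-sign S f f-inc k k∈S
  ... | inj₁ (_ , 0<P) = 0<P
  ... | inj₂ (odd , _) = ⊥-elim (even⇒odd-suc _ even odd)

module Radius (R : Reals) where
  open Reals R
  open OrderedField R

  Within : ℝ → (ℝ → Set) → Set
  Within ε Φ = ∀ δ → δ < ε → - δ < ε → Φ δ

  within-shrink : ∀ {ε ε′ Φ} → ε′ ≤ ε → Within ε Φ → Within ε′ Φ
  within-shrink ε′≤ε Φ-within δ δ<ε′ -δ<ε′ = Φ-within δ (<-≤-trans δ<ε′ ε′≤ε) (<-≤-trans -δ<ε′ ε′≤ε)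

  positive-lower-bound : ∀ {a b} → 0r < a → 0r < b → Σ ℝ (λ ε → 0r < ε × ε ≤ a × ε ≤ b)
  positive-lower-bound {a} {b} 0<a 0<b with <-trichotomy a b
  ... | inj₁ a<b = a , 0<a , inj₂ refl , inj₁ a<b
  ... | inj₂ (inj₁ a≡b) = a , 0<a , inj₂ refl , inj₂ a≡b
  ... | inj₂ (inj₂ b<a) = b , 0<b , inj₁ b<a , inj₂ refl

  common-radius : ∀ m (Φ : Fin m → ℝ → Set) → (∀ j → Σ ℝ (λ ε → 0r < ε × Within ε (Φ j))) →
                  Σ ℝ (λ ε → 0r < ε × (∀ j → Within ε (Φ j)))
  common-radius zero Φ _ = 1r , 0<1 , λ ()
  common-radius (suc m) Φ radii with radii Fin.zero | common-radius m (λ j → Φ (Fin.suc j)) (λ j → radii (Fin.suc j))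
  ... | (ε₀ , 0<ε₀ , Φ₀) | (ε₁ , 0<ε₁ , Φ₁) with positive-lower-bound 0<ε₀ 0<ε₁
  ... | (ε , 0<ε , ε≤ε₀ , ε≤ε₁) = ε , 0<ε , within
    where
    within : ∀ j → Within ε (Φ j)
    within Fin.zero = within-shrink ε≤ε₀ Φ₀
    within (Fin.suc j) = within-shrink ε≤ε₁ (Φ₁ j)

  one-sided-radius : ∀ {b} Q → 0r < b → Σ ℝ (λ ε → 0r < ε × (∀ x → 0r ≤ x → x < ε → x * Q < b))
  one-sided-radius {b} Q 0<b with <-trichotomy 0r Q
  ... | inj₂ (inj₁ refl) = 1r , 0<1 , λ x _ _ → ≤-<-trans (inj₂ (zeroʳ x)) 0<b
  ... | inj₂ (inj₂ Q<0) = 1r , 0<1 , λ x 0≤x _ → ≤-<-trans (nonneg*nonpos 0≤x (inj₁ Q<0)) 0<b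
  ... | inj₁ 0<Q with *-invʳ Q (λ Q≡0 → <⇒≢ 0<Q (sym Q≡0))
  ...   | (Q⁻¹ , QQ⁻¹≡1) = b * Q⁻¹ , *-pos b Q⁻¹ 0<b (inverse-pos 0<Q QQ⁻¹≡1) ,
          λ x _ x<ε → subst (x * Q <_) bQ⁻¹Q≡b (*-monoʳ-< 0<Q x<ε)
    where
    bQ⁻¹Q≡b : b * Q⁻¹ * Q ≡ b
    bQ⁻¹Q≡b = trans (*-assoc b Q⁻¹ Q) (trans (cong (b *_) (trans (*-comm Q⁻¹ Q) QQ⁻¹≡1)) (*-idʳ b))

  product-radius : ∀ {b} Q → 0r < b → Σ ℝ (λ ε → 0r < ε × Within ε (λ δ → δ * Q < b))
  product-radius {b} Q 0<b with one-sided-radius Q 0<b | one-sided-radius (- Q) 0<b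
  ... | (ε₊ , 0<ε₊ , small₊) | (ε₋ , 0<ε₋ , small₋) with positive-lower-bound 0<ε₊ 0<ε₋
  ... | (ε , 0<ε , ε≤ε₊ , ε≤ε₋) = ε , 0<ε , within
    where
    within : Within ε (λ δ → δ * Q < b)
    within δ δ<ε -δ<ε with <-trichotomy 0r δ
    ... | inj₁ 0<δ = small₊ δ (inj₁ 0<δ) (<-≤-trans δ<ε ε≤ε₊)
    ... | inj₂ (inj₁ 0≡δ) = small₊ δ (inj₂ 0≡δ) (<-≤-trans δ<ε ε≤ε₊)
    ... | inj₂ (inj₂ δ<0) =
          subst (_< b) (-x*-y≡x*y δ Q) (small₋ (- δ) (inj₁ (x<0⇒0<-x δ<0)) (<-≤-trans -δ<ε ε≤ε₋))

  right-window : ∀ {τ λ′ ε} → 0r < ε → τ ≤ λ′ → λ′ < τ + ε →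
                 0r ≤ λ′ - τ × λ′ - τ < ε × - (λ′ - τ) < ε
  right-window {τ} {λ′} {ε} 0<ε τ≤λ′ λ′<τ+ε =
    0≤δ , subst (λ′ - τ <_) (xyx⁻¹≈y τ ε) (+-mono-< λ′ (τ + ε) (- τ) λ′<τ+ε) , ≤-<-trans (0≤x⇒-x≤0 0≤δ) 0<ε
    where
    0≤δ : 0r ≤ λ′ - τ
    0≤δ = x≤y⇒0≤y-x τ≤λ′

  left-window : ∀ {τ λ′ ε} → 0r < ε → τ - ε < λ′ → λ′ ≤ τ →
                λ′ - τ ≤ 0r × λ′ - τ < ε × - (λ′ - τ) < ε
  left-window {τ} {λ′} {ε} 0<ε τ-ε<λ′ λ′≤τ =
    δ≤0 , ≤-<-trans δ≤0 0<ε , subst (_< ε) (sym (⁻¹-anti-homo‿- λ′ τ)) (x-y<z⇒x-z<y τ-ε<λ′)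
    where
    δ≤0 : λ′ - τ ≤ 0r
    δ≤0 = x≤y⇒x-y≤0 λ′≤τ

module Displacement (R : Reals) {M : ℕ} (p c : Fin (suc M) → Reals.ℝ R) where
  open Reals R
  open OrderedField R
  open Polynomials R
  open Radius R
  open Setting R p c
  open ≡-Reasoning

  AgreeBeyond : Fin M → Point → Point → Set
  AgreeBeyond n t t₀ = ∀ r → toℕ n ℕ.< toℕ r → t r ≡ t₀ r

  D : Point → Point → ℝ → ℝ
  D t t₀ y = Σ[ (λ r → (y ^ suc (toℕ r)) * (t r - t₀ r)) ]

  θ-move : ∀ a t t₀ → θ a t ≡ θ a t₀ + D t t₀ (p a)
  θ-move a t t₀ = begin
    Σ[ (λ r → P r * t r) ] + c a                                       ≡⟨ cong (_+ c a) (Σ-cong split) ⟩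
    Σ[ (λ r → P r * t₀ r + P r * (t r - t₀ r)) ] + c a                 ≡⟨ cong (_+ c a) (Σ-+ (λ r → P r * t₀ r) (λ r → P r * (t r - t₀ r))) ⟩
    Σ[ (λ r → P r * t₀ r) ] + Σ[ (λ r → P r * (t r - t₀ r)) ] + c a    ≡⟨ [x+y]+z≡[x+z]+y _ _ _ ⟩
    θ a t₀ + D t t₀ (p a)                                              ∎
    where
    P : Fin M → ℝ
    P r = p a ^ suc (toℕ r)
    split : ∀ r → P r * t r ≡ P r * t₀ r + P r * (t r - t₀ r)
    split r = trans (cong (P r *_) (sym (x+[y-x]≡y (t₀ r) (t r)))) (distribˡ (P r) (t₀ r) (t r - t₀ r))

  -- Interpolation: let t and t₀ lie on 𝒫_S with |S| = n + 1 and agree beyond n.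
  -- Then D - D(p_i) (any i ∈ S) has degree ≤ n + 1, leading coefficient
  -- t^(n) - t₀^(n) and the roots p_l, l ∈ S, so it is determined at every p_j.
  D-formula : Injective _≡_ _≡_ p → (S : Subset (suc M)) (n : Fin M) → ∣ S ∣ ≡ suc (toℕ n) →
              ∀ t t₀ → InP S t → InP S t₀ → AgreeBeyond n t t₀ → ∀ i → i ∈ S → ∀ j →
              D t t₀ (p j) ≡ D t t₀ (p i) + (t n - t₀ n) * ∏ S (λ l → p j - p l)
  D-formula p-inj S n ∣S∣≡n+1 t t₀ t∈P t₀∈P agree i i∈S j = -x+y≡z⇒y≡x+z _ _ _ (begin
    - Dᵢ + D t t₀ (p j)                     ≡⟨ sym (eval-Q (p j)) ⟩
    eval Q (p j)                            ≡⟨ factor-theorem S p p-inj ∣S∣≡n+1 Q roots (p j) ⟩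
    last Q * ∏ S (λ l → p j - p l)          ≡⟨ cong (_* ∏ S (λ l → p j - p l)) (last-prefix n d) ⟩
    (t n - t₀ n) * ∏ S (λ l → p j - p l)    ∎)
    where
    d : Fin M → ℝ
    d r = t r - t₀ r
    Dᵢ : ℝ
    Dᵢ = D t t₀ (p i)
    Q : Vec ℝ (suc (suc (toℕ n)))
    Q = - Dᵢ ∷ prefix n d
    eval-Q : ∀ y → eval Q y ≡ - Dᵢ + D t t₀ y
    eval-Q y = cong (- Dᵢ +_) (sym (power-sum-as-horner n d d-vanishes y))
      where
      d-vanishes : ∀ r → toℕ n ℕ.< toℕ r → d r ≡ 0r
      d-vanishes r n<r = trans (cong (_- t₀ r) (agree r n<r)) (+-invʳ (t₀ r))
    -- D takes the same value at all p_l, l ∈ S, since θ_l = θ_i there at t and at t₀.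
    D-constant : ∀ l → l ∈ S → D t t₀ (p l) ≡ Dᵢ
    D-constant l l∈S = +-cancelˡ (θ l t₀) _ _ (begin
      θ l t₀ + D t t₀ (p l)   ≡⟨ sym (θ-move l t t₀) ⟩
      θ l t                   ≡⟨ t∈P l i l∈S i∈S ⟩
      θ i t                   ≡⟨ θ-move i t t₀ ⟩
      θ i t₀ + Dᵢ             ≡⟨ cong (_+ Dᵢ) (t₀∈P i l i∈S l∈S) ⟩
      θ l t₀ + Dᵢ             ∎)
    roots : ∀ l → l ∈ S → eval Q (p l) ≡ 0r
    roots l l∈S = trans (eval-Q (p l)) (trans (cong (- Dᵢ +_) (D-constant l l∈S)) (-‿inverseˡ Dᵢ))

  visibility-criterion : Injective _≡_ _≡_ p → (S : Subset (suc M)) (n : Fin M) → ∣ S ∣ ≡ suc (toℕ n) →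
    ∀ t t₀ (m : ℝ) → InP S t → AgreeBeyond n t t₀ → (∀ i → i ∈ S → θ i t₀ ≡ m) →
    (∀ j → j ∉ S → (t n - t₀ n) * ∏ S (λ l → p j - p l) ≤ m - θ j t₀) → InU S t
  visibility-criterion p-inj S n ∣S∣≡n+1 t t₀ m t∈P agree level bound i i∈S j with j ∈? S
  ... | yes j∈S = inj₂ (t∈P j i j∈S i∈S)
  ... | no j∉S = subst₂ _≤_ (sym θⱼ) θᵢ (+-monoˡ-≤ (θ j t₀) (+-monoˡ-≤ Dᵢ (bound j j∉S)))
    where
    Dᵢ : ℝ
    Dᵢ = D t t₀ (p i)
    t₀∈P : InP S t₀
    t₀∈P a b a∈S b∈S = trans (level a a∈S) (sym (level b b∈S))
    θⱼ : θ j t ≡ θ j t₀ + (Dᵢ + (t n - t₀ n) * ∏ S (λ l → p j - p l))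
    θⱼ = trans (θ-move j t t₀) (cong (θ j t₀ +_) (D-formula p-inj S n ∣S∣≡n+1 t t₀ t∈P t₀∈P agree i i∈S j))
    θᵢ : θ j t₀ + (Dᵢ + (m - θ j t₀)) ≡ θ i t
    θᵢ = begin
      θ j t₀ + (Dᵢ + (m - θ j t₀))  ≡⟨ x+[y+z]≡y+[x+z] (θ j t₀) Dᵢ (m - θ j t₀) ⟩
      Dᵢ + (θ j t₀ + (m - θ j t₀))  ≡⟨ cong (Dᵢ +_) (x+[y-x]≡y (θ j t₀) m) ⟩
      Dᵢ + m                        ≡⟨ +-comm Dᵢ m ⟩
      m + Dᵢ                        ≡⟨ cong (_+ Dᵢ) (sym (level i i∈S)) ⟩
      θ i t₀ + Dᵢ                   ≡⟨ sym (θ-move i t t₀) ⟩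
      θ i t                         ∎

  VisibleAfterMove : Subset (suc M) → Fin M → Point → ℝ → ℝ → Set
  VisibleAfterMove S n t₀ m δ =
    (∀ j → j ∉ S → θ j t₀ ≡ m → δ * ∏ S (λ l → p j - p l) ≤ 0r) →
    ∀ t → InP S t → AgreeBeyond n t t₀ → t n - t₀ n ≡ δ → InU S t

  stable-visibility : Injective _≡_ _≡_ p → (S : Subset (suc M)) (n : Fin M) → ∣ S ∣ ≡ suc (toℕ n) →
    ∀ t₀ (m : ℝ) → (∀ i → i ∈ S → θ i t₀ ≡ m) → (∀ j → θ j t₀ ≤ m) →
    Σ ℝ (λ ε → 0r < ε × Within ε (VisibleAfterMove S n t₀ m))
  stable-visibility p-inj S n ∣S∣≡n+1 t₀ m level below = ε , 0<ε , visible
    where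
    P : Fin (suc M) → ℝ
    P j = ∏ S (λ l → p j - p l)
    Φ : Fin (suc M) → ℝ → Set
    Φ j δ = θ j t₀ < m → δ * P j < m - θ j t₀
    radius : ∀ j → Σ ℝ (λ ε → 0r < ε × Within ε (Φ j))
    radius j with <-trichotomy (θ j t₀) m
    ... | inj₁ θⱼ<m with product-radius (P j) (x<y⇒0<y-x θⱼ<m)
    ...   | (ε , 0<ε , small) = ε , 0<ε , λ δ δ<ε -δ<ε _ → small δ δ<ε -δ<ε
    radius j | inj₂ (inj₁ θⱼ≡m) = 1r , 0<1 , λ _ _ _ θⱼ<m → ⊥-elim (<⇒≢ θⱼ<m θⱼ≡m)
    radius j | inj₂ (inj₂ m<θⱼ) = 1r , 0<1 , λ _ _ _ θⱼ<m → ⊥-elim (<-irrefl (θ j t₀) (<-trans _ _ _ θⱼ<m m<θⱼ))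
    common : Σ ℝ (λ ε → 0r < ε × (∀ j → Within ε (Φ j)))
    common = common-radius (suc M) Φ radius
    ε : ℝ
    ε = proj₁ common
    0<ε : 0r < ε
    0<ε = proj₁ (proj₂ common)
    small : ∀ j → Within ε (Φ j)
    small = proj₂ (proj₂ common)
    visible : Within ε (VisibleAfterMove S n t₀ m)
    visible δ δ<ε -δ<ε ties t t∈P agree tₙ-moved =
      visibility-criterion p-inj S n ∣S∣≡n+1 t t₀ m t∈P agree level bound
      where
      bound : ∀ j → j ∉ S → (t n - t₀ n) * P j ≤ m - θ j t₀
      bound j j∉S with below j
      ... | inj₁ θⱼ<m = inj₁ (subst (λ x → x * P j < m - θ j t₀) (sym tₙ-moved)
                                (small j δ δ<ε -δ<ε θⱼ<m))
      ... | inj₂ θⱼ≡m = subst₂ (λ x y → x * P j ≤ y) (sym tₙ-moved) m-θⱼ≡0 (ties j j∉S θⱼ≡m)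
        where
        m-θⱼ≡0 : 0r ≡ m - θ j t₀
        m-θⱼ≡0 = sym (trans (cong (λ x → m - x) θⱼ≡m) (+-invʳ m))

  moved-point : ∀ (n : Fin M) {K K′ : Subset (suc M)} {s t₀ t : Point} λ′ →
                ∣ K ∣ ≡ suc (suc (toℕ n)) → ∣ K′ ∣ ≡ suc (toℕ n) →
                IsTJ K s t₀ → IsTJ K′ (updateAt s n (λ _ → λ′)) t → AgreeBeyond n t t₀ × t n ≡ λ′
  moved-point n {s = s} {t₀} {t} λ′ ∣K∣≡n+2 ∣K′∣≡n+1 (_ , t₀-fixed) (_ , t-fixed) = agree , tₙ≡λ′
    where
    agree : AgreeBeyond n t t₀
    agree r n<r = begin
      t r                         ≡⟨ t-fixed r (subst (ℕ._≤ suc (toℕ r)) (sym ∣K′∣≡n+1) (ℕ.s≤s (ℕₚ.<⇒≤ n<r))) ⟩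
      updateAt s n (λ _ → λ′) r   ≡⟨ updateAt-minimal r n s (λ r≡n → ℕₚ.<⇒≢ n<r (cong toℕ (sym r≡n))) ⟩
      s r                         ≡⟨ sym (t₀-fixed r (subst (ℕ._≤ suc (toℕ r)) (sym ∣K∣≡n+2) (ℕ.s≤s n<r))) ⟩
      t₀ r                        ∎
    tₙ≡λ′ : t n ≡ λ′
    tₙ≡λ′ = trans (t-fixed n (subst (ℕ._≤ suc (toℕ n)) (sym ∣K′∣≡n+1) ℕₚ.≤-refl)) (updateAt-updates n s)

  generic-ties : ∀ K t₀ → 2 ℕ.≤ ∣ K ∣ → InP K t₀ → Generic K t₀ → ∀ k → k ∈ K →
                 ∀ j → j ∉ K ─ ⁅ k ⁆ → θ j t₀ ≡ θ k t₀ → j ≡ k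
  generic-ties K t₀ 2≤∣K∣ t₀∈P generic k k∈K j j∉K′ θⱼ≡θₖ with j ∈? K | j ≟ᶠ k
  ... | _ | yes j≡k = j≡k
  ... | yes j∈K | no j≢k = ⊥-elim (j∉K′ (x∈p∧x≢y⇒x∈p-y j∈K j≢k))
  ... | no j∉K | no _ = ⊥-elim (generic (K ∪ ⁅ j ⁆) 2≤∣K∪j∣ (λ K∪j⊆K → j∉K (K∪j⊆K (q⊆p∪q K ⁅ j ⁆ (x∈⁅x⁆ j)))) K∪j∈P)
    where
    2≤∣K∪j∣ : 2 ℕ.≤ ∣ K ∪ ⁅ j ⁆ ∣
    2≤∣K∪j∣ = ℕₚ.≤-trans 2≤∣K∣ (p⊆q⇒∣p∣≤∣q∣ {p = K} (p⊆p∪q ⁅ j ⁆))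
    at-level : ∀ a → a ∈ K ∪ ⁅ j ⁆ → θ a t₀ ≡ θ k t₀
    at-level a a∈ with x∈p∪q⁻ K ⁅ j ⁆ a∈
    ... | inj₁ a∈K = t₀∈P a k a∈K k∈K
    ... | inj₂ a∈⁅j⁆ = trans (cong (λ b → θ b t₀) (x∈⁅y⁆⇒x≡y j a∈⁅j⁆)) θⱼ≡θₖ
    K∪j∈P : InP (K ∪ ⁅ j ⁆) t₀
    K∪j∈P a b a∈ b∈ = trans (at-level a a∈) (sym (at-level b b∈))

  visible-near : Injective _≡_ _≡_ p → ∀ (n : Fin M) K s t₀ → ∣ K ∣ ≡ suc (suc (toℕ n)) →
    IsTJ K s t₀ → Generic K t₀ → Visible K t₀ → ∀ k → k ∈ K →
    Σ ℝ (λ ε → 0r < ε × ∀ λ′ → λ′ - t₀ n < ε → - (λ′ - t₀ n) < ε →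
      (λ′ - t₀ n) * ∏ (K ─ ⁅ k ⁆) (λ l → p k - p l) ≤ 0r →
      ∀ t → IsTJ (K ─ ⁅ k ⁆) (updateAt s n (λ _ → λ′)) t → Visible (K ─ ⁅ k ⁆) t)
  visible-near p-inj n K s t₀ ∣K∣≡n+2 t₀-def generic (t₀∈P , t₀∈U) k k∈K = ε , 0<ε , visible
    where
    K′ : Subset (suc M)
    K′ = K ─ ⁅ k ⁆
    ∣K′∣≡n+1 : ∣ K′ ∣ ≡ suc (toℕ n)
    ∣K′∣≡n+1 = ℕₚ.suc-injective (trans (∣S─k∣+1≡∣S∣ K k k∈K) ∣K∣≡n+2)
    -- Base the moves at t₀ with level θ_k(t₀), which is the maximum since t₀ is visible.
    stable : Σ ℝ (λ ε → 0r < ε × Within ε (VisibleAfterMove K′ n t₀ (θ k t₀)))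
    stable = stable-visibility p-inj K′ n ∣K′∣≡n+1 t₀ (θ k t₀)
               (λ i i∈K′ → t₀∈P i k (p─q⊆p K ⁅ k ⁆ i∈K′) k∈K) (t₀∈U k k∈K)
    ε : ℝ
    ε = proj₁ stable
    0<ε : 0r < ε
    0<ε = proj₁ (proj₂ stable)
    moves-visible : Within ε (VisibleAfterMove K′ n t₀ (θ k t₀))
    moves-visible = proj₂ (proj₂ stable)
    2≤∣K∣ : 2 ℕ.≤ ∣ K ∣
    2≤∣K∣ = subst (2 ℕ.≤_) (sym ∣K∣≡n+2) (ℕ.s≤s (ℕ.s≤s ℕ.z≤n))
    visible : ∀ λ′ → λ′ - t₀ n < ε → - (λ′ - t₀ n) < ε → (λ′ - t₀ n) * ∏ K′ (λ l → p k - p l) ≤ 0r →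
              ∀ t → IsTJ K′ (updateAt s n (λ _ → λ′)) t → Visible K′ t
    visible λ′ δ<ε -δ<ε sign t t-def@(t∈P , _) with moved-point n λ′ ∣K∣≡n+2 ∣K′∣≡n+1 t₀-def t-def
    ... | agree , tₙ≡λ′ = t∈P , moves-visible (λ′ - t₀ n) δ<ε -δ<ε only-k t t∈P agree (cong (_- t₀ n) tₙ≡λ′)
      where
      -- By genericity the only tie outside K′ is k, whose sign condition is given.
      only-k : ∀ j → j ∉ K′ → θ j t₀ ≡ θ k t₀ → (λ′ - t₀ n) * ∏ K′ (λ l → p j - p l) ≤ 0r
      only-k j j∉K′ tie = subst (λ i → (λ′ - t₀ n) * ∏ K′ (λ l → p i - p l) ≤ 0r)
        (sym (generic-ties K t₀ 2≤∣K∣ t₀∈P generic k k∈K j j∉K′ tie)) sign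

proposition3p11 : (R : Reals) → let open Reals R in
    (M : ℕ) (p c : Fin (suc M) → ℝ) →
    (∀ i j → i <ᶠ j → p i < p j) →
    let open Setting R p c in
    (n : Fin M) →
    (K : Subset (suc M)) → ∣ K ∣ ≡ suc (suc (toℕ n)) →
    (s : Point) (t₀ : Point) →
    IsTJ K s t₀ → Generic K t₀ → Visible K t₀ →
    ∀ k → k ∈ K →
    Σ ℝ (λ ε → 0r < ε ×
    ((InLt K k → ∀ λ′ → t₀ n ≤ λ′ → λ′ < t₀ n + ε →
    ∀ t → IsTJ (K ─ ⁅ k ⁆) (updateAt s n (λ _ → λ′)) t → Visible (K ─ ⁅ k ⁆) t) ×
    (InGt K k → ∀ λ′ → t₀ n - ε < λ′ → λ′ ≤ t₀ n →
    ∀ t → IsTJ (K ─ ⁅ k ⁆) (updateAt s n (λ _ → λ′)) t → Visible (K ─ ⁅ k ⁆) t)))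
proposition3p11 R M p c p-increasing n K ∣K∣≡n+2 s t₀ t₀-def generic visible k k∈K
  with Displacement.visible-near R p c (ProductSign.strictlyIncreasing⇒injective R p-increasing)
         n K s t₀ ∣K∣≡n+2 t₀-def generic visible k k∈K
... | ε , 0<ε , visible-if = ε , 0<ε , after , before
  where
  open Reals R
  open OrderedField R
  open ProductSign R
  open Radius R
  open Setting R p c
  after : InLt K k → ∀ λ′ → t₀ n ≤ λ′ → λ′ < t₀ n + ε →
          ∀ t → IsTJ (K ─ ⁅ k ⁆) (updateAt s n (λ _ → λ′)) t → Visible (K ─ ⁅ k ⁆) t
  after k∈K< λ′ τ≤λ′ λ′<τ+ε with right-window 0<ε τ≤λ′ λ′<τ+ε
  ... | 0≤δ , δ<ε , -δ<ε =
        visible-if λ′ δ<ε -δ<ε (nonneg*nonpos 0≤δ (inj₁ (InLt⇒∏<0 K p p-increasing k k∈K<)))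
  before : InGt K k → ∀ λ′ → t₀ n - ε < λ′ → λ′ ≤ t₀ n →
           ∀ t → IsTJ (K ─ ⁅ k ⁆) (updateAt s n (λ _ → λ′)) t → Visible (K ─ ⁅ k ⁆) t
  before k∈K> λ′ τ-ε<λ′ λ′≤τ with left-window 0<ε τ-ε<λ′ λ′≤τ
  ... | δ≤0 , δ<ε , -δ<ε = visible-if λ′ δ<ε -δ<ε
        (subst (_≤ 0r) (*-comm _ _) (nonneg*nonpos (inj₁ (InGt⇒0<∏ K p p-increasing k k∈K>)) δ≤0))
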